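{- Let $c$ be a proper edge coloring of $K_n$ and let $k\ge 1$ be an integer. If $P$ is a $(k-1)$-rainbow path, then there is a maximal $k$-rainbow path $P'$ with $|C_k(P')| \le |V(P')| - |V(P)|$.
   Context: A proper edge coloring of $K_n=(V,E)$ is a map $c\colon E\to\mathbb{N}$ such that any two distinct edges sharing an endpoint receive different colors. A $k$-rainbow path is a path in which no color appears on more than $k$ of its edges (a $0$-rainbow path is a single vertex). For a path $P$ and $i\ge 1$, $C_i(P)$ is the set of colors used on exactly $i$ edges of $P$. For a $k$-rainbow path $P=(p_1,\dots,p_t)$, $C_A(P)=\{c(p_i,p_{i+1}) : 1\le i\le t-1,\ c(p_1,p_{i+1})\notin C_k(P)\}$, where $c(u,v)$ is the color of the edge $\{u,v\}$. Writing $V(P)^c=V\setminus V(P)$ and $c(v,S)$ for the set of colors of the edges $\{v,s\}$, $s\in S$, a $k$-rainbow path $P=(p_1,\dots,p_t)$ is called maximal if $c(p_1,V(P)^c)\subseteq C_k(P)$ and $c(p_t,V(P)^c)\subseteq C_k(P)\setminus C_A(P)$. -}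

module Defs where

open import Data.Nat using (ℕ; _≤_; _+_; _≟_)
open import Data.Fin using (Fin)
open import Data.List using (List; []; _∷_; length; filter; deduplicate)
open import Data.List.Relation.Unary.Unique.Propositional using (Unique)
open import Data.List.Membership.Propositional using (_∈_; _∉_)
open import Data.Product using (_×_; ∃; ∃-syntax; _,_)
open import Data.Empty using (⊥)
open import Relation.Nullary using (¬_)
open import Relation.Binary.PropositionalEquality using (_≡_; _≢_)

-- An edge colouring of K_n: colour of edge {u,v} is c u v (diagonal values irrelevant).
Coloring : ℕ → Set
Coloring n = Fin n → Fin n → ℕ

ProperColoring : (n : ℕ) → Coloring n → Set
ProperColoring n c =
  (∀ u v → u ≢ v → c u v ≡ c v u) ×
  (∀ u v w → u ≢ v → u ≢ w → v ≢ w → c u v ≢ c u w)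

IsPath : ∀ {n} → List (Fin n) → Set
IsPath P = Unique P × P ≢ []

edges : ∀ {n} → List (Fin n) → List (Fin n × Fin n)
edges [] = []
edges (x ∷ []) = []
edges (x ∷ y ∷ r) = (x , y) ∷ edges (y ∷ r)

edgeColors : ∀ {n} → Coloring n → List (Fin n) → List ℕ
edgeColors c [] = []
edgeColors c (x ∷ []) = []
edgeColors c (x ∷ y ∷ r) = c x y ∷ edgeColors c (y ∷ r)

mult : ∀ {n} → Coloring n → List (Fin n) → ℕ → ℕ
mult c P a = length (filter (a ≟_) (edgeColors c P))

InC : ∀ {n} → ℕ → Coloring n → List (Fin n) → ℕ → Set
InC i c P a = mult c P a ≡ i

-- |C_i(P)| (colours used on exactly i edges; meaningful for i ≥ 1)
cardC : ∀ {n} → ℕ → Coloring n → List (Fin n) → ℕ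
cardC i c P = length (filter (λ a → mult c P a ≟ i) (deduplicate _≟_ (edgeColors c P)))

Rainbow : ∀ {n} → ℕ → Coloring n → List (Fin n) → Set
Rainbow k c P = ∀ a → mult c P a ≤ k

InCA : ∀ {n} → ℕ → Coloring n → Fin n → List (Fin n) → ℕ → Set
InCA k c p₁ r a =
  ∃[ e ] (e ∈ edges (p₁ ∷ r)) ×
    (let (x , y) = e in a ≡ c x y × ¬ InC k c (p₁ ∷ r) (c p₁ y))

lastOf : ∀ {n} → Fin n → List (Fin n) → Fin n
lastOf p [] = p
lastOf p (q ∷ r) = lastOf q r

-- Maximal k-rainbow path (the k-rainbow condition is stated separately).
Maximal : ∀ {n} → ℕ → Coloring n → List (Fin n) → Set
Maximal k c [] = ⊥
Maximal k c (p ∷ r) =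
  ∀ v → v ∉ (p ∷ r) →
    InC k c (p ∷ r) (c p v) ×
    InC k c (p ∷ r) (c (lastOf p r) v) ×
    ¬ InCA k c p r (c (lastOf p r) v)

-- Grow the path greedily, keeping it k-rainbow with |C_k(Q)| ≤ |V(Q)| - |V(P)|. If
-- Q = (p₁,…,p_t) is not maximal, some outside vertex v gives a longer path: prepend v when
-- c(p₁,v) ∉ C_k(Q), append v when c(p_t,v) ∉ C_k(Q), and when c(p_t,v) = c(p_i,p_{i+1}) with
-- c(p₁,p_{i+1}) ∉ C_k(Q) take (p_i,…,p₁,p_{i+1},…,p_t,v), which trades the edge p_i p_{i+1}
-- for p₁ p_{i+1} and p_t v. In every case the colour multiset of the path gains exactly one
-- colour outside C_k(Q), so the path stays k-rainbow and |C_k| grows by at most one while the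
-- path grows by one vertex; as paths have at most n vertices, the process ends at a maximal
-- path.

module Submission where

open import Defs
open import Data.Nat using (ℕ; zero; suc; _≤_; _<_; _+_; _∸_; _≟_; z≤n; s≤s)
open import Data.Nat.Properties
  using (≤-trans; ≤-reflexive; ≤∧≢⇒<; +-monoˡ-≤; +-suc; m≤n+m; n≤1+n; +-identityʳ; <⇒≢; <⇒≱; module ≤-Reasoning)
open import Data.Fin using (Fin) renaming (_≟_ to _≟ᶠ_)
import Data.Fin.Properties as Fin
open import Data.List using (List; []; _∷_; _++_; _∷ʳ_; [_]; length; filter; deduplicate; reverse)
open import Data.List.Properties
  using (filter-accept; filter-reject; filter-none; unfold-reverse; ++-assoc; length-tabulate)
open import Data.List.Relation.Unary.All as All using ([]; _∷_)
open import Data.List.Relation.Unary.All.Properties using (++⁻ˡ; ¬Any⇒All¬)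
open import Data.List.Relation.Unary.Any as Any using (here; there)
open import Data.List.Relation.Unary.Unique.Propositional using (Unique; []; _∷_)
open import Data.List.Relation.Unary.Unique.Propositional.Properties using (filter⁺)
open import Data.List.Relation.Unary.Unique.DecPropositional.Properties using (deduplicate-!)
open import Data.List.Membership.Propositional using (_∈_; _∉_; find; lose)
open import Data.List.Membership.Propositional.Properties
  using (∈-∃++; ∈-allFin; ∈-filter⁺; ∈-filter⁻; ∈-deduplicate⁺)
open import Data.List.Relation.Binary.Subset.Propositional using (_⊆_)
open import Data.List.Relation.Binary.Permutation.Propositional
  using (_↭_; ↭-refl; ↭-sym; ↭-trans; ↭-reflexive; ↭-prep; ↭⇒↭ₛ; module PermutationReasoning)
open import Data.List.Relation.Binary.Permutation.Propositional.Properties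
  using (↭-length; filter-↭; ∈-resp-↭; shift; ∷↭∷ʳ; ↭-reverse; ++⁺; ++⁺ʳ)
open import Data.List.Relation.Binary.Permutation.Setoid.Properties using (Unique-resp-↭)
open import Data.Product using (_×_; _,_; ∃; ∃₂; ∃-syntax)
open import Data.Sum using (_⊎_; inj₁; inj₂)
open import Relation.Nullary using (¬_; Dec; yes; no; ¬?; contradiction)
open import Relation.Nullary.Decidable using (map′; _×-dec_; _⊎-dec_; decidable-stable)
open import Function using (_∘_; id)
open import Relation.Binary.PropositionalEquality
  using (_≡_; _≢_; refl; sym; trans; cong; cong₂; subst; setoid)

Unique-++⁻ˡ : ∀ {A : Set} (xs : List A) {ys} → Unique (xs ++ ys) → Unique xs
Unique-++⁻ˡ []       _           = []
Unique-++⁻ˡ (x ∷ xs) (x∉ ∷ xs!) = ++⁻ˡ xs x∉ ∷ Unique-++⁻ˡ xs xs!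

Unique⇒length≤ : ∀ {A : Set} {xs ys : List A} → Unique xs → xs ⊆ ys → length xs ≤ length ys
Unique⇒length≤ {xs = []} _ _ = z≤n
Unique⇒length≤ {xs = x ∷ xs} (x∉xs ∷ xs!) xs⊆ys
  with h , t , refl ← ∈-∃++ (xs⊆ys (here refl)) =
  subst (suc (length xs) ≤_) (sym (↭-length (shift x h t))) (s≤s (Unique⇒length≤ xs! xs⊆h++t))
  where
  xs⊆h++t : xs ⊆ h ++ t
  xs⊆h++t {z} z∈xs with ∈-resp-↭ (shift x h t) (xs⊆ys (there z∈xs))
  ... | here z≡x  = contradiction (sym z≡x) (All.lookup x∉xs z∈xs)
  ... | there z∈  = z∈

Unique⇒length≤n : ∀ {n} {xs : List (Fin n)} → Unique xs → length xs ≤ n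
Unique⇒length≤n {n} {xs} xs! =
  subst (length xs ≤_) (length-tabulate {n = n} id) (Unique⇒length≤ xs! (λ {v} _ → ∈-allFin v))

grow-until-done : ∀ {A : Set} (size : A → ℕ) (Inv Done : A → Set) bound →
  (∀ {x} → Inv x → size x ≤ bound) →
  (∀ {x} → Inv x → Done x ⊎ ∃[ y ] (Inv y × size x < size y)) →
  ∀ {x} → Inv x → ∃[ y ] (Inv y × Done y)
grow-until-done size Inv Done bound bounded step {x} inv = go (suc bound) (m≤n+m _ (size x)) inv
  where
  go : ∀ fuel {x} → bound < size x + fuel → Inv x → ∃[ y ] (Inv y × Done y)
  go fuel {x} slack inv with step inv
  go fuel        {x} slack inv | inj₁ done = x , inv , done
  go zero        {x} slack inv | inj₂ _ =
    contradiction (bounded inv) (<⇒≱ (subst (bound <_) (+-identityʳ (size x)) slack))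
  go (suc fuel)  {x} slack inv | inj₂ (y , inv′ , x<y) =
    go fuel (≤-trans slack (≤-trans (≤-reflexive (+-suc (size x) fuel)) (+-monoˡ-≤ fuel x<y))) inv′

-- mult c P and cardC k c P are definitionally multiplicity (edgeColors c P) and
-- length (coloursOfMultiplicity k (edgeColors c P)), so these lemmas apply to paths directly.
multiplicity : List ℕ → ℕ → ℕ
multiplicity L a = length (filter (a ≟_) L)

multiplicity-↭ : ∀ {L L′} a → L ↭ L′ → multiplicity L a ≡ multiplicity L′ a
multiplicity-↭ a L↭L′ = ↭-length (filter-↭ (a ≟_) L↭L′)

multiplicity-∷-≡ : ∀ L a → multiplicity (a ∷ L) a ≡ suc (multiplicity L a)
multiplicity-∷-≡ L a = cong length (filter-accept (a ≟_) refl)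

multiplicity-∷-≢ : ∀ L {a b} → a ≢ b → multiplicity (b ∷ L) a ≡ multiplicity L a
multiplicity-∷-≢ L {a} a≢b = cong length (filter-reject (a ≟_) a≢b)

≤-multiplicity-insert : ∀ {k L L′ b} → (∀ a → multiplicity L a ≤ k) → multiplicity L b ≢ k →
  L′ ↭ b ∷ L → ∀ a → multiplicity L′ a ≤ k
≤-multiplicity-insert {k} {L} {b = b} L≤k Lb≢k L′↭ a
  rewrite multiplicity-↭ a L′↭ with a ≟ b
... | yes refl = subst (_≤ k) (sym (multiplicity-∷-≡ L a)) (≤∧≢⇒< (L≤k a) Lb≢k)
... | no a≢b   = subst (_≤ k) (sym (multiplicity-∷-≢ L a≢b)) (L≤k a)

multiplicity>0⇒∈ : ∀ L {a} → 0 < multiplicity L a → a ∈ L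
multiplicity>0⇒∈ (x ∷ L) {a} pos with a ≟ x
... | yes a≡x = here a≡x
... | no a≢x   = there (multiplicity>0⇒∈ L (subst (0 <_) (multiplicity-∷-≢ L a≢x) pos))

coloursOfMultiplicity : ℕ → List ℕ → List ℕ
coloursOfMultiplicity k L = filter (λ a → multiplicity L a ≟ k) (deduplicate _≟_ L)

coloursOfMultiplicity-insert : ∀ {k L L′ b} → 0 < k → L′ ↭ b ∷ L →
  coloursOfMultiplicity k L′ ⊆ b ∷ coloursOfMultiplicity k L
coloursOfMultiplicity-insert {k} {L} {L′} {b} k>0 L′↭ {a} a∈
  with ∈-filter⁻ (λ a → multiplicity L′ a ≟ k) {xs = deduplicate _≟_ L′} a∈ | a ≟ b
... | _ | yes a≡b = here a≡b
... | _ , L′a≡k | no a≢b =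
  there (∈-filter⁺ (λ a → multiplicity L a ≟ k) (∈-deduplicate⁺ _≟_ a∈L) La≡k)
  where
  La≡k : multiplicity L a ≡ k
  La≡k = trans (sym (trans (multiplicity-↭ a L′↭) (multiplicity-∷-≢ L a≢b))) L′a≡k
  a∈L : a ∈ L
  a∈L = multiplicity>0⇒∈ L (subst (0 <_) (sym La≡k) k>0)

length-coloursOfMultiplicity-insert : ∀ {k L L′ b} → 0 < k → L′ ↭ b ∷ L →
  length (coloursOfMultiplicity k L′) ≤ suc (length (coloursOfMultiplicity k L))
length-coloursOfMultiplicity-insert {k} {L′ = L′} k>0 L′↭ =
  Unique⇒length≤ (filter⁺ (λ a → multiplicity L′ a ≟ k) (deduplicate-! _≟_ L′))
                 (coloursOfMultiplicity-insert k>0 L′↭)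

coloursOfMultiplicity-empty : ∀ {k L} → (∀ a → multiplicity L a < k) → coloursOfMultiplicity k L ≡ []
coloursOfMultiplicity-empty {k} {L} L<k =
  filter-none (λ a → multiplicity L a ≟ k) {xs = deduplicate _≟_ L} (All.tabulate λ {a} _ → <⇒≢ (L<k a))

module _ {n : ℕ} where

  lastOf-++ : ∀ (p : Fin n) zs y ys → lastOf p (zs ++ y ∷ ys) ≡ lastOf y ys
  lastOf-++ p []       y ys = refl
  lastOf-++ p (z ∷ zs) y ys = lastOf-++ z zs y ys

  reverse-lastOf : ∀ (p : Fin n) zs → ∃₂ λ w ws → reverse (p ∷ zs) ≡ w ∷ ws × lastOf w ws ≡ p
  reverse-lastOf p zs with reverse zs | unfold-reverse p zs
  ... | []     | rev≡ = p , [] , rev≡ , refl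
  ... | u ∷ us | rev≡ = u , us ∷ʳ p , rev≡ , lastOf-++ u us p []

  edges-split : ∀ {x y : Fin n} p r → (x , y) ∈ edges (p ∷ r) →
    ∃₂ λ zs ys → r ≡ zs ++ y ∷ ys × lastOf p zs ≡ x
  edges-split p (q ∷ r) (here refl) = [] , r , refl , refl
  edges-split p (q ∷ r) (there e∈)
    with zs , ys , refl , last≡ ← edges-split q r e∈ = q ∷ zs , ys , refl , last≡

  edgeColors-join : ∀ (c : Coloring n) z zs y ys →
    edgeColors c (z ∷ zs ++ y ∷ ys) ≡ edgeColors c (z ∷ zs) ++ c (lastOf z zs) y ∷ edgeColors c (y ∷ ys)
  edgeColors-join c z []       y ys = refl
  edgeColors-join c z (w ∷ ws) y ys = cong (c z w ∷_) (edgeColors-join c w ws y ys)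

  edgeColors-reverse : ∀ (c : Coloring n) → (∀ u v → u ≢ v → c u v ≡ c v u) →
    ∀ {xs} → Unique xs → edgeColors c (reverse xs) ↭ edgeColors c xs
  edgeColors-reverse c c-sym {[]}         _ = ↭-refl
  edgeColors-reverse c c-sym {x ∷ []}     _ = ↭-refl
  edgeColors-reverse c c-sym {x ∷ y ∷ ys} ((x≢y ∷ _) ∷ y∷ys!)
    with w , ws , rev≡ , last≡ ← reverse-lastOf y ys = begin
    edgeColors c (reverse (x ∷ y ∷ ys))            ≡⟨ cong (edgeColors c) (unfold-reverse x (y ∷ ys)) ⟩
    edgeColors c (reverse (y ∷ ys) ∷ʳ x)           ≡⟨ cong (λ zs → edgeColors c (zs ∷ʳ x)) rev≡ ⟩
    edgeColors c (w ∷ ws ++ [ x ])                 ≡⟨ edgeColors-join c w ws x [] ⟩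
    edgeColors c (w ∷ ws) ∷ʳ c (lastOf w ws) x
      ≡⟨ cong₂ (λ zs a → edgeColors c zs ∷ʳ a) (sym rev≡) c-last ⟩
    edgeColors c (reverse (y ∷ ys)) ∷ʳ c x y
      ↭⟨ ∷↭∷ʳ (c x y) _ ⟨
    c x y ∷ edgeColors c (reverse (y ∷ ys))
      ↭⟨ ↭-prep (c x y) (edgeColors-reverse c c-sym y∷ys!) ⟩
    c x y ∷ edgeColors c (y ∷ ys)
      ∎
    where
    open PermutationReasoning hiding (step-prep; step-swap)
    c-last : c (lastOf w ws) x ≡ c x y
    c-last = trans (cong (λ u → c u x) last≡) (c-sym y x (x≢y ∘ sym))

rainbow⇒cardC-suc≡0 : ∀ {n k} (c : Coloring n) P → Rainbow k c P → cardC (suc k) c P ≡ 0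
rainbow⇒cardC-suc≡0 c P rainbow =
  cong length (coloursOfMultiplicity-empty {L = edgeColors c P} (s≤s ∘ rainbow))

module _ {n : ℕ} (c : Coloring n) (k : ℕ) where

  Extension : List (Fin n) → Fin n → List (Fin n) → Set
  Extension Q v Q′ = Q′ ↭ v ∷ Q × ∃[ b ] (edgeColors c Q′ ↭ b ∷ edgeColors c Q × ¬ InC k c Q b)

  Invariant : ℕ → List (Fin n) → Set
  Invariant m Q = IsPath Q × Rainbow k c Q × cardC k c Q + m ≤ length Q

  Invariant-extension : ∀ {m Q v Q′} → 0 < k → v ∉ Q → Invariant m Q → Extension Q v Q′ →
    Invariant m Q′ × length Q < length Q′
  Invariant-extension {m} {Q} {v} {Q′} k>0 v∉Q ((Q! , _) , rainbow , card) (Q′↭ , b , colours↭ , b∉Cₖ) =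
    ((Q′! , Q′≢[]) , rainbow′ , card′) , ≤-reflexive (sym length≡)
    where
    length≡ : length Q′ ≡ suc (length Q)
    length≡ = ↭-length Q′↭
    Q′! : Unique Q′
    Q′! = Unique-resp-↭ (setoid (Fin n)) (↭⇒↭ₛ (↭-sym Q′↭)) (¬Any⇒All¬ Q v∉Q ∷ Q!)
    Q′≢[] : Q′ ≢ []
    Q′≢[] refl with () ← length≡
    rainbow′ : Rainbow k c Q′
    rainbow′ = ≤-multiplicity-insert rainbow b∉Cₖ colours↭
    card′ : cardC k c Q′ + m ≤ length Q′
    card′ = begin
      cardC k c Q′ + m        ≤⟨ +-monoˡ-≤ m (length-coloursOfMultiplicity-insert k>0 colours↭) ⟩
      suc (cardC k c Q + m)   ≤⟨ s≤s card ⟩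
      suc (length Q)          ≡⟨ length≡ ⟨
      length Q′               ∎
      where open ≤-Reasoning

  append-extension : ∀ {p r v} → ¬ InC k c (p ∷ r) (c (lastOf p r) v) →
    Extension (p ∷ r) v (p ∷ r ++ [ v ])
  append-extension {p} {r} {v} c-tv∉Cₖ =
    ↭-sym (∷↭∷ʳ v (p ∷ r)) , c (lastOf p r) v , colours , c-tv∉Cₖ
    where
    colours : edgeColors c (p ∷ r ++ [ v ]) ↭ c (lastOf p r) v ∷ edgeColors c (p ∷ r)
    colours = ↭-trans (↭-reflexive (edgeColors-join c p r v [])) (↭-sym (∷↭∷ʳ _ _))

  Extendable : Fin n → List (Fin n) → Fin n → Set
  Extendable p r v = v ∉ p ∷ r ×
    (¬ InC k c (p ∷ r) (c p v) ⊎ ¬ InC k c (p ∷ r) (c (lastOf p r) v) ⊎ InCA k c p r (c (lastOf p r) v))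

  InCA? : ∀ p r a → Dec (InCA k c p r a)
  InCA? p r a = map′ find (λ (_ , e∈ , pe) → lose e∈ pe)
    (Any.any? (λ (x , y) → (a ≟ c x y) ×-dec ¬? (mult c (p ∷ r) (c p y) ≟ k)) (edges (p ∷ r)))

  extendable? : ∀ p r v → Dec (Extendable p r v)
  extendable? p r v = ¬? (v ∈? p ∷ r) ×-dec
    (¬? (mult c (p ∷ r) (c p v) ≟ k) ⊎-dec
     ¬? (mult c (p ∷ r) (c (lastOf p r) v) ≟ k) ⊎-dec
     InCA? p r (c (lastOf p r) v))
    where open import Data.List.Membership.DecPropositional (_≟ᶠ_ {n}) using (_∈?_)

  maximal-or-extendable : ∀ p r → Maximal k c (p ∷ r) ⊎ ∃ (Extendable p r)
  maximal-or-extendable p r with Fin.any? (extendable? p r)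
  ... | yes ext = inj₂ ext
  ... | no ¬ext = inj₁ λ v v∉ →
    decidable-stable (mult c (p ∷ r) (c p v) ≟ k) (λ ne → ¬ext (v , v∉ , inj₁ ne)) ,
    decidable-stable (mult c (p ∷ r) (c (lastOf p r) v) ≟ k) (λ ne → ¬ext (v , v∉ , inj₂ (inj₁ ne))) ,
    λ ca → ¬ext (v , v∉ , inj₂ (inj₂ ca))

  module _ (c-sym : ∀ u v → u ≢ v → c u v ≡ c v u) where

    prepend-extension : ∀ {p r v} → v ∉ p ∷ r → ¬ InC k c (p ∷ r) (c p v) →
      Extension (p ∷ r) v (v ∷ p ∷ r)
    prepend-extension {p} {r} {v} v∉ c-pv∉Cₖ =
      ↭-refl , c p v , ↭-reflexive (cong (_∷ edgeColors c (p ∷ r)) (c-sym v p (v∉ ∘ here))) , c-pv∉Cₖ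

    rotation-extension : ∀ {p r v} → Unique (p ∷ r) → InCA k c p r (c (lastOf p r) v) →
      ∃[ Q′ ] Extension (p ∷ r) v Q′
    rotation-extension {p} {r} {v} p∷r! ((x , y) , xy∈ , c-tv≡c-xy , c-py∉Cₖ)
      with zs , ys , refl , last≡x ← edges-split p r xy∈
      with w , ws , rev≡ , last-rev≡p ← reverse-lastOf p zs
      = w ∷ ws ++ y ∷ ys ++ [ v ] , vertices , c p y , colours , c-py∉Cₖ
      where
      open PermutationReasoning hiding (step-prep; step-swap)
      vertices : w ∷ ws ++ y ∷ ys ++ [ v ] ↭ v ∷ p ∷ zs ++ y ∷ ys
      vertices = begin
        w ∷ ws ++ y ∷ ys ++ [ v ]            ≡⟨ cong (_++ y ∷ ys ++ [ v ]) rev≡ ⟨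
        reverse (p ∷ zs) ++ y ∷ ys ++ [ v ]  ↭⟨ ++⁺ʳ _ (↭-reverse (p ∷ zs)) ⟩
        (p ∷ zs) ++ y ∷ ys ++ [ v ]          ≡⟨ ++-assoc (p ∷ zs) (y ∷ ys) [ v ] ⟨
        (p ∷ zs ++ y ∷ ys) ++ [ v ]          ↭⟨ ∷↭∷ʳ v _ ⟨
        v ∷ p ∷ zs ++ y ∷ ys                 ∎
      c-last≡c-xy : c (lastOf y ys) v ≡ c x y
      c-last≡c-xy = trans (cong (λ u → c u v) (sym (lastOf-++ p zs y ys))) c-tv≡c-xy
      suffix-colours : edgeColors c (y ∷ ys ++ [ v ]) ≡ edgeColors c (y ∷ ys) ++ [ c x y ]
      suffix-colours = trans (edgeColors-join c y ys v [])
        (cong (λ u → edgeColors c (y ∷ ys) ++ [ u ]) c-last≡c-xy)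
      prefix-colours : edgeColors c (w ∷ ws) ↭ edgeColors c (p ∷ zs)
      prefix-colours = subst (λ qs → edgeColors c qs ↭ edgeColors c (p ∷ zs)) rev≡
        (edgeColors-reverse c c-sym (Unique-++⁻ˡ (p ∷ zs) p∷r!))
      colours : edgeColors c (w ∷ ws ++ y ∷ ys ++ [ v ]) ↭ c p y ∷ edgeColors c (p ∷ zs ++ y ∷ ys)
      colours = begin
        edgeColors c (w ∷ ws ++ y ∷ ys ++ [ v ])
          ≡⟨ edgeColors-join c w ws y (ys ++ [ v ]) ⟩
        edgeColors c (w ∷ ws) ++ c (lastOf w ws) y ∷ edgeColors c (y ∷ ys ++ [ v ])
          ≡⟨ cong₂ (λ u cs → edgeColors c (w ∷ ws) ++ c u y ∷ cs) last-rev≡p suffix-colours ⟩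
        (edgeColors c (w ∷ ws) ++ c p y ∷ edgeColors c (y ∷ ys) ++ [ c x y ])
          ↭⟨ shift (c p y) (edgeColors c (w ∷ ws)) _ ⟩
        c p y ∷ (edgeColors c (w ∷ ws) ++ edgeColors c (y ∷ ys) ++ [ c x y ])
          ↭⟨ ↭-prep (c p y) (++⁺ prefix-colours (↭-sym (∷↭∷ʳ (c x y) _))) ⟩
        c p y ∷ edgeColors c (p ∷ zs) ++ c x y ∷ edgeColors c (y ∷ ys)
          ≡⟨ cong (λ u → c p y ∷ edgeColors c (p ∷ zs) ++ c u y ∷ edgeColors c (y ∷ ys)) last≡x ⟨
        c p y ∷ edgeColors c (p ∷ zs) ++ c (lastOf p zs) y ∷ edgeColors c (y ∷ ys)
          ≡⟨ cong (c p y ∷_) (edgeColors-join c p zs y ys) ⟨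
        c p y ∷ edgeColors c (p ∷ zs ++ y ∷ ys)
          ∎

    extendable⇒extension : ∀ {p r v} → Unique (p ∷ r) → Extendable p r v →
      ∃[ Q′ ] Extension (p ∷ r) v Q′
    extendable⇒extension _     (v∉ , inj₁ c-pv∉Cₖ)        = _ , prepend-extension v∉ c-pv∉Cₖ
    extendable⇒extension _     (_  , inj₂ (inj₁ c-tv∉Cₖ)) = _ , append-extension c-tv∉Cₖ
    extendable⇒extension p∷r! (_  , inj₂ (inj₂ c-tv∈Cₐ)) = rotation-extension p∷r! c-tv∈Cₐ

    maximal-or-extend : ∀ {m Q} → 0 < k → Invariant m Q →
      Maximal k c Q ⊎ ∃[ Q′ ] (Invariant m Q′ × length Q < length Q′)
    maximal-or-extend {Q = []}    _   ((_ , []≢[]) , _) = contradiction refl []≢[]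
    maximal-or-extend {Q = p ∷ r} k>0 inv@((p∷r! , _) , _) with maximal-or-extendable p r
    ... | inj₁ maximal       = inj₁ maximal
    ... | inj₂ (v , v∉ , ext) with Q′ , extension ← extendable⇒extension p∷r! (v∉ , ext) =
      inj₂ (Q′ , Invariant-extension k>0 v∉ inv extension)

lemma3 : (n : ℕ) (c : Coloring n) → ProperColoring n c →
    (k : ℕ) → 1 ≤ k →
    (P : List (Fin n)) → IsPath P → Rainbow (k ∸ 1) c P →
    ∃[ P′ ] (IsPath P′ × Rainbow k c P′ × Maximal k c P′ ×
      cardC k c P′ + length P ≤ length P′)
lemma3 n c (c-sym , _) (suc k) k>0 P path rainbow
  with P′ , (path′ , rainbow′ , card′) , maximal ←
         grow-until-done length (Invariant c (suc k) (length P)) (Maximal (suc k) c) n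
           (λ ((P′! , _) , _) → Unique⇒length≤n P′!)
           (maximal-or-extend c (suc k) c-sym k>0)
           (path , (λ a → ≤-trans (rainbow a) (n≤1+n k)) ,
            ≤-reflexive (cong (_+ length P) (rainbow⇒cardC-suc≡0 c P rainbow)))
  = P′ , path′ , rainbow′ , maximal , card′
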